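{- Let the polynomials $P_m(z)$, $m\ge 0$, be defined by \[ \sum_{m=0}^{\infty}P_m(z)t^m=\frac{1}{t^4z^2+t^3(-2z-36)+t^2(49-2z)-14t+1}. \] Then for every $m\ge 0$, the degree of $P_m(z)$ is at most $\lfloor m/2\rfloor$. -}

module Defs where

open import Data.Nat using (ℕ; zero; suc; _∸_; _<_)
open import Relation.Binary.PropositionalEquality using (_≡_)
open import Data.Integer using (ℤ; +_; -[1+_]; _+_; _*_)
open import Data.List using (List; []; _∷_; map; foldr; upTo)

-- Polynomials in z with integer coefficients, as coefficient lists
-- (lowest degree first; trailing zeros allowed).
Poly : Set
Poly = List ℤ

coeff : Poly → ℕ → ℤ
coeff []       _       = + 0
coeff (a ∷ p)  zero    = a
coeff (a ∷ p)  (suc i) = coeff p i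

_⊕_ : Poly → Poly → Poly
[]      ⊕ q       = q
(a ∷ p) ⊕ []      = a ∷ p
(a ∷ p) ⊕ (b ∷ q) = (a + b) ∷ (p ⊕ q)

scale : ℤ → Poly → Poly
scale c = map (c *_)

_⊛_ : Poly → Poly → Poly
[]      ⊛ q = []
(a ∷ p) ⊛ q = scale a q ⊕ (+ 0 ∷ (p ⊛ q))

DegreeAtMost : ℕ → Poly → Set
DegreeAtMost d p = ∀ i → d < i → coeff p i ≡ + 0

-- Formal power series in t with coefficients in ℤ[z]: ℕ → Poly.
-- Cauchy product coefficient: (a·b)_m = Σ_{j=0}^{m} a_j b_{m-j}
sumP : List Poly → Poly
sumP = foldr _⊕_ []

cauchy : (ℕ → Poly) → (ℕ → Poly) → ℕ → Poly
cauchy a b m = sumP (map (λ j → a j ⊛ b (m ∸ j)) (upTo (suc m)))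

-- Denominator  1 - 14 t + (49 - 2z) t^2 + (-2z - 36) t^3 + z^2 t^4
denom : ℕ → Poly
denom 0 = + 1 ∷ []
denom 1 = -[1+ 13 ] ∷ []
denom 2 = + 49 ∷ -[1+ 1 ] ∷ []
denom 3 = -[1+ 35 ] ∷ -[1+ 1 ] ∷ []
denom 4 = + 0 ∷ + 0 ∷ + 1 ∷ []
denom _ = []

one : ℕ → Poly
one zero    = + 1 ∷ []
one (suc _) = []

-- P is the coefficient sequence of 1/denom, i.e. denom · P = 1
-- (coefficientwise in z as well).
IsGenFun : (ℕ → Poly) → Set
IsGenFun P = ∀ m i → coeff (cauchy denom P m) i ≡ coeff (one m) i

{-# OPTIONS --safe #-}
-- Reading off the coefficient of t^m in denom · P = 1 gives the recurrence
-- P_m = [m = 0] − Σ_{1 ≤ j ≤ m} d_j P_{m−j}, where d_j is the coefficient of t^j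
-- of the denominator. Every d_j has z-degree at most ⌊j/2⌋, and
-- ⌊j/2⌋ + ⌊(m−j)/2⌋ ≤ ⌊m/2⌋, so strong induction on m bounds deg P_m by ⌊m/2⌋.
module Submission where

open import Defs
open import Data.Nat using (ℕ; _/_)
open import Data.Nat.Base using (zero; suc; _+_; _∸_; _≤_; _<_; z≤n; s≤s; z<s; ⌊_/2⌋)
open import Data.Nat.Properties
  using (≤-refl; ≤-<-trans; ≤-trans; m≤n+m; ∸-monoʳ-<; m+[n∸m]≡n; ⌊n/2⌋-mono; n≤1+n)
open import Data.Nat.DivMod using (m/n≡1+[m∸n]/n)
open import Data.Nat.Induction using (<-rec)
open import Data.Integer.Base using (+_; _*_) renaming (_+_ to _+ℤ_)
open import Data.Integer.Properties using (+-identityˡ; +-identityʳ; *-zeroʳ; *-identityˡ)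
open import Data.List.Base using (List; []; _∷_; length; map; applyUpTo)
open import Data.List.Relation.Unary.All using (All; []; _∷_)
open import Data.List.Relation.Unary.All.Properties using (map⁺; applyUpTo⁺₁)
open import Relation.Binary.PropositionalEquality using (_≡_; refl; sym; trans; cong; cong₂; subst; module ≡-Reasoning)

/2≡⌊/2⌋ : ∀ n → n / 2 ≡ ⌊ n /2⌋
/2≡⌊/2⌋ 0             = refl
/2≡⌊/2⌋ 1             = refl
/2≡⌊/2⌋ (suc (suc n)) = trans (m/n≡1+[m∸n]/n {suc (suc n)} (s≤s (s≤s z≤n))) (cong suc (/2≡⌊/2⌋ n))

⌊m/2⌋+⌊n/2⌋≤⌊m+n/2⌋ : ∀ m n → ⌊ m /2⌋ + ⌊ n /2⌋ ≤ ⌊ m + n /2⌋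
⌊m/2⌋+⌊n/2⌋≤⌊m+n/2⌋ 0             n = ≤-refl
⌊m/2⌋+⌊n/2⌋≤⌊m+n/2⌋ 1             n = ⌊n/2⌋-mono (n≤1+n n)
⌊m/2⌋+⌊n/2⌋≤⌊m+n/2⌋ (suc (suc m)) n = s≤s (⌊m/2⌋+⌊n/2⌋≤⌊m+n/2⌋ m n)

⌊j/2⌋+⌊m∸j/2⌋≤⌊m/2⌋ : ∀ {j m} → j ≤ m → ⌊ j /2⌋ + ⌊ m ∸ j /2⌋ ≤ ⌊ m /2⌋
⌊j/2⌋+⌊m∸j/2⌋≤⌊m/2⌋ {j} {m} j≤m =
  subst (λ k → ⌊ j /2⌋ + ⌊ m ∸ j /2⌋ ≤ ⌊ k /2⌋) (m+[n∸m]≡n j≤m) (⌊m/2⌋+⌊n/2⌋≤⌊m+n/2⌋ j (m ∸ j))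

coeff-⊕ : ∀ p q i → coeff (p ⊕ q) i ≡ coeff p i +ℤ coeff q i
coeff-⊕ []      q       i       = sym (+-identityˡ _)
coeff-⊕ (a ∷ p) []      i       = sym (+-identityʳ _)
coeff-⊕ (a ∷ p) (b ∷ q) zero    = refl
coeff-⊕ (a ∷ p) (b ∷ q) (suc i) = coeff-⊕ p q i

coeff-scale : ∀ c p i → coeff (scale c p) i ≡ c * coeff p i
coeff-scale c []      i       = sym (*-zeroʳ c)
coeff-scale c (a ∷ p) zero    = refl
coeff-scale c (a ∷ p) (suc i) = coeff-scale c p i

coeff-[1]⊛ : ∀ q i → coeff ((+ 1 ∷ []) ⊛ q) i ≡ coeff q i
coeff-[1]⊛ q i = begin
  coeff (scale (+ 1) q ⊕ (+ 0 ∷ [])) i              ≡⟨ coeff-⊕ (scale (+ 1) q) _ i ⟩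
  coeff (scale (+ 1) q) i +ℤ coeff (+ 0 ∷ []) i     ≡⟨ cong₂ _+ℤ_ (trans (coeff-scale (+ 1) q i) (*-identityˡ _)) (coeff-[0] i) ⟩
  coeff q i +ℤ + 0                                  ≡⟨ +-identityʳ _ ⟩
  coeff q i                                         ∎
  where
  open ≡-Reasoning
  coeff-[0] : ∀ j → coeff (+ 0 ∷ []) j ≡ + 0
  coeff-[0] zero    = refl
  coeff-[0] (suc j) = refl

coeff-≥length : ∀ p {i} → length p ≤ i → coeff p i ≡ + 0
coeff-≥length []      _           = refl
coeff-≥length (a ∷ p) (s≤s len≤i) = coeff-≥length p len≤i

coeff-⊛-null : ∀ p q → (∀ i → coeff p i ≡ + 0) → ∀ i → coeff (p ⊛ q) i ≡ + 0
coeff-⊛-null []      q p≡0 i = refl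
coeff-⊛-null (a ∷ p) q p≡0 i = begin
  coeff (scale a q ⊕ (+ 0 ∷ (p ⊛ q))) i             ≡⟨ coeff-⊕ (scale a q) _ i ⟩
  coeff (scale a q) i +ℤ coeff (+ 0 ∷ (p ⊛ q)) i    ≡⟨ cong₂ _+ℤ_ scaled≡0 (shifted≡0 i) ⟩
  + 0                                               ∎
  where
  open ≡-Reasoning
  scaled≡0 : coeff (scale a q) i ≡ + 0
  scaled≡0 = trans (coeff-scale a q i) (cong (_* coeff q i) (p≡0 0))
  shifted≡0 : ∀ j → coeff (+ 0 ∷ (p ⊛ q)) j ≡ + 0
  shifted≡0 zero    = refl
  shifted≡0 (suc j) = coeff-⊛-null p q (λ k → p≡0 (suc k)) j

DegreeAtMost-mono : ∀ {d e p} → d ≤ e → DegreeAtMost d p → DegreeAtMost e p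
DegreeAtMost-mono d≤e deg i e<i = deg i (≤-<-trans d≤e e<i)

DegreeAtMost-length : ∀ {d} p → length p ≤ suc d → DegreeAtMost d p
DegreeAtMost-length p len≤1+d i d<i = coeff-≥length p (≤-trans len≤1+d d<i)

DegreeAtMost-∷ : ∀ {d p} a → DegreeAtMost d p → DegreeAtMost (suc d) (a ∷ p)
DegreeAtMost-∷ a deg (suc i) (s≤s d<i) = deg i d<i

DegreeAtMost-⊕ : ∀ {d} p q → DegreeAtMost d p → DegreeAtMost d q → DegreeAtMost d (p ⊕ q)
DegreeAtMost-⊕ p q degp degq i d<i =
  trans (coeff-⊕ p q i) (cong₂ _+ℤ_ (degp i d<i) (degq i d<i))

DegreeAtMost-scale : ∀ {d} c p → DegreeAtMost d p → DegreeAtMost d (scale c p)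
DegreeAtMost-scale c p deg i d<i = trans (coeff-scale c p i) (trans (cong (c *_) (deg i d<i)) (*-zeroʳ c))

DegreeAtMost-sumP : ∀ {d ps} → All (DegreeAtMost d) ps → DegreeAtMost d (sumP ps)
DegreeAtMost-sumP {ps = []}     []            = λ _ _ → refl
DegreeAtMost-sumP {ps = p ∷ ps} (degp ∷ degs) = DegreeAtMost-⊕ p (sumP ps) degp (DegreeAtMost-sumP degs)

DegreeAtMost-⊛ : ∀ {d e} p q → DegreeAtMost d p → DegreeAtMost e q → DegreeAtMost (d + e) (p ⊛ q)
DegreeAtMost-⊛         []      q degp degq = λ _ _ → refl
DegreeAtMost-⊛ {d} {e} (a ∷ p) q degp degq =
  DegreeAtMost-⊕ (scale a q) _ (DegreeAtMost-scale a q (DegreeAtMost-mono {p = q} (m≤n+m e d) degq)) (shifted d degp)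
  where
  shifted : ∀ d → DegreeAtMost d (a ∷ p) → DegreeAtMost (d + e) (+ 0 ∷ (p ⊛ q))
  shifted zero    degp (suc i) _ = coeff-⊛-null p q (λ k → degp (suc k) (s≤s z≤n)) i
  shifted (suc d) degp         = DegreeAtMost-∷ (+ 0) (DegreeAtMost-⊛ p q (λ i d<i → degp (suc i) (s≤s d<i)) degq)

denom-length : ∀ j → length (denom j) ≤ suc ⌊ j /2⌋
denom-length 0                             = ≤-refl
denom-length 1                             = ≤-refl
denom-length 2                             = ≤-refl
denom-length 3                             = ≤-refl
denom-length 4                             = ≤-refl
denom-length (suc (suc (suc (suc (suc j))))) = z≤n

denom-degree : ∀ j → DegreeAtMost ⌊ j /2⌋ (denom j)
denom-degree j = DegreeAtMost-length (denom j) (denom-length j)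

one-degree : ∀ {d} m → DegreeAtMost d (one m)
one-degree zero    (suc i) _ = refl
one-degree (suc m) i       _ = refl

module _ (P : ℕ → Poly) (isGenFun : IsGenFun P) where

  P-degree : ∀ m → DegreeAtMost ⌊ m /2⌋ (P m)
  P-degree = <-rec (λ m → DegreeAtMost ⌊ m /2⌋ (P m)) step
    where
    step : ∀ m → (∀ {n} → n < m → DegreeAtMost ⌊ n /2⌋ (P n)) → DegreeAtMost ⌊ m /2⌋ (P m)
    step m ih i ⌊m/2⌋<i = begin
      coeff (P m) i                                   ≡⟨ sym (coeff-[1]⊛ (P m) i) ⟩
      coeff (denom 0 ⊛ P m) i                         ≡⟨ sym (+-identityʳ _) ⟩
      coeff (denom 0 ⊛ P m) i +ℤ + 0                  ≡⟨ cong (coeff (denom 0 ⊛ P m) i +ℤ_) (sym (DegreeAtMost-sumP lower-terms i ⌊m/2⌋<i)) ⟩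
      coeff (denom 0 ⊛ P m) i +ℤ coeff (sumP rest) i  ≡⟨ sym (coeff-⊕ (denom 0 ⊛ P m) (sumP rest) i) ⟩
      coeff (cauchy denom P m) i                      ≡⟨ isGenFun m i ⟩
      coeff (one m) i                                 ≡⟨ one-degree m i ⌊m/2⌋<i ⟩
      + 0                                             ∎
      where
      open ≡-Reasoning
      term : ℕ → Poly
      term j = denom j ⊛ P (m ∸ j)
      rest : List Poly
      rest = map term (applyUpTo suc m)
      term-degree : ∀ {k} → k < m → DegreeAtMost ⌊ m /2⌋ (term (suc k))
      term-degree {k} k<m =
        DegreeAtMost-mono {p = term (suc k)} (⌊j/2⌋+⌊m∸j/2⌋≤⌊m/2⌋ k<m)
          (DegreeAtMost-⊛ (denom (suc k)) (P (m ∸ suc k)) (denom-degree (suc k)) (ih (∸-monoʳ-< z<s k<m)))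
      lower-terms : All (DegreeAtMost ⌊ m /2⌋) rest
      lower-terms = map⁺ (applyUpTo⁺₁ suc m term-degree)

lemma2 : (P : ℕ → Poly) → IsGenFun P → ∀ m → DegreeAtMost (m / 2) (P m)
lemma2 P isGenFun m rewrite /2≡⌊/2⌋ m = P-degree P isGenFun m
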